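{- Let $k,l\in\mathbb N$ with $l>0$. A matrix $M\in\mathrm{Mat}$ satisfies $M=M_{(\mathbb N-[k])\times[l]}$, $\epsilon^{\uparrow}_i(M)=0$ for all $i\ge k$, and $\epsilon^{\rightarrow}_j(M)=0$ for all $j\in[l-1]$, if and only if there exists a partition $\lambda$ with $\lambda_l=0$ such that $M$ is the sliced form $\mathrm{sl}(\lambda,k,l)$, i.e. $M_{i,j}=[i\ge k][j<l](\lambda_{m-1}-\lambda_m)$ for all $i,j\in\mathbb N$, where $m=i-k-j+l$.
   Context: $\mathbb N=\{0,1,\dots\}$, $[n]=\{0,\dots,n-1\}$, $\mathbb N-[k]=\{k,k+1,\dots\}$; $[\cdot]$ applied to a condition denotes $1$ if true and $0$ otherwise. $\mathrm{Mat}$ is the set of $\mathbb N$-valued matrices $(M_{i,j})_{i,j\in\mathbb N}$ with finitely many nonzero entries; $M_{I\times J}$ keeps the entries in $I\times J$ and sets the others to $0$. Partitions are weakly decreasing sequences $(\lambda_0,\lambda_1,\dots)$ in $\mathbb N$ with finitely many nonzero terms. For $M\in\mathrm{Mat}$: $\epsilon^{\uparrow}_i(M)=\max_{c\in\mathbb N}\big(\sum_{j\le c}M_{i+1,j}-\sum_{j<c}M_{i,j}\big)$ (number of possible upward transfers from row $i+1$ to row $i$), and $\epsilon^{\rightarrow}_j(M)=\max_{r\in\mathbb N}\big(\sum_{i\ge r}M_{i,j}-\sum_{i>r}M_{i,j+1}\big)$ (number of possible rightward transfers from column $j$ to column $j+1$). -}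

module Defs where

open import Data.Nat using (ℕ; zero; suc; _+_; _∸_; _≤_; _<_; _≤ᵇ_; _<ᵇ_)
open import Data.Bool using (if_then_else_; _∧_)
open import Data.Integer as ℤ using (ℤ; +_)
open import Data.Product using (Σ; ∃; _×_)
open import Relation.Binary.PropositionalEquality using (_≡_)

sumTo : (ℕ → ℕ) → ℕ → ℕ
sumTo f zero    = 0
sumTo f (suc n) = sumTo f n + f n

record Mat : Set where
  field
    entry   : ℕ → ℕ → ℕ
    bound   : ℕ
    support : ∀ i j → (bound ≤ i → entry i j ≡ 0) × (bound ≤ j → entry i j ≡ 0)
open Mat public

restrictEntry : ℕ → ℕ → Mat → ℕ → ℕ → ℕ
restrictEntry k l M i j = if (k ≤ᵇ i) ∧ (j <ᵇ l) then entry M i j else 0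

IsMax : (ℕ → ℤ) → ℤ → Set
IsMax f v = (∃ λ c → f c ≡ v) × (∀ c → f c ℤ.≤ v)

upQty : Mat → ℕ → ℕ → ℤ
upQty M i c = + sumTo (entry M (suc i)) (suc c) ℤ.- + sumTo (entry M i) c

εUp≡ : Mat → ℕ → ℤ → Set
εUp≡ M i v = IsMax (upQty M i) v

-- Σ_{i≥r} M_{i,j}  (a finite sum, since entries vanish for i ≥ bound)
colTailFrom : Mat → ℕ → ℕ → ℕ
colTailFrom M r j = sumTo (λ i → if r ≤ᵇ i then entry M i j else 0) (bound M)

rightQty : Mat → ℕ → ℕ → ℤ
rightQty M j r = + colTailFrom M r j ℤ.- + colTailFrom M (suc r) (suc j)

εRight≡ : Mat → ℕ → ℤ → Set
εRight≡ M j v = IsMax (rightQty M j) v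

record Partition : Set where
  field
    part       : ℕ → ℕ
    decreasing : ∀ n → part (suc n) ≤ part n
    finite     : ∃ λ N → ∀ n → N ≤ n → part n ≡ 0
open Partition public

-- sl(λ,k,l)_{i,j} = [i≥k][j<l](λ_{m-1} − λ_m),  m = i − k − j + l
-- (when i ≥ k and j < l, m = (i∸k)+(l∸j) ≥ 1, so m-1 and m are natural numbers)
slEntry : Partition → ℕ → ℕ → ℕ → ℕ → ℕ
slEntry λp k l i j =
  if (k ≤ᵇ i) ∧ (j <ᵇ l)
  then part λp (((i ∸ k) + (l ∸ j)) ∸ 1) ∸ part λp ((i ∸ k) + (l ∸ j))
  else 0

-- Write Sᵢ(c) for the sum of the first c entries of row i and Tⱼ(r) for the sum of column j
-- from row r down.  The conditions ε↑ᵢ = 0 and ε→ⱼ = 0 say Sᵢ₊₁(c + 1) ≤ Sᵢ(c) and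
-- Tⱼ(r) ≤ Tⱼ₊₁(r + 1).  Taking c = 0 shows that column 0 vanishes below row k; taking
-- c = l - 1 and summing over the rows from r on turns the first family into
-- Σⱼ Tⱼ₊₁(r + 1) ≤ Σⱼ Tⱼ(r), so every inequality of the second family is an equality, and
-- differencing in r shows that M is constant along the diagonals i - j below row k.  Hence M
-- is determined by its row k, and λₙ = S_k(l - n) is the partition whose sliced form is M.
-- Conversely, in a sliced form every Sᵢ(c) and Tⱼ(r) is a single part of λ, and the two
-- conditions reduce to the monotonicity of λ.
module Submission where

import Algebra.Properties.CommutativeSemigroup
open import Data.Bool using (T; true; false; if_then_else_; _∧_)
open import Data.Bool.Properties using (T-∧)
open import Data.Integer as ℤ using (+_)
import Data.Integer.Properties as ℤ
open import Data.Nat using (ℕ; zero; suc; _+_; _∸_; _≤_; _<_; _≤′_; _≤ᵇ_; _<ᵇ_; z≤n; s≤s; ≤′-refl; ≤′-step)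
open import Data.Nat.Properties
open import Data.Product using (∃; _×_; _,_; proj₁; proj₂)
open import Data.Sum using (inj₁; inj₂)
open import Data.Unit using (tt)
open import Function using (_∘_; flip)
open import Function.Bundles using (_⇔_; mk⇔; Equivalence)
open import Level using (0ℓ)
open import Relation.Binary using (Rel; Reflexive; Transitive)
open import Relation.Binary.PropositionalEquality
open import Relation.Nullary using (¬_; yes; no; contradiction)

open import Defs

open Equivalence using (to; from)
open Algebra.Properties.CommutativeSemigroup +-commutativeSemigroup using (interchange; xy∙z≈xz∙y)

if-T : ∀ {b} {x y : ℕ} → T b → (if b then x else y) ≡ x
if-T {true} _ = refl

if-¬T : ∀ {b} {x y : ℕ} → ¬ T b → (if b then x else y) ≡ y
if-¬T {true}  ¬t = contradiction tt ¬t
if-¬T {false} _  = refl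

if-then-0-cong : ∀ b {x y : ℕ} → (T b → x ≡ y) → (if b then x else 0) ≡ (if b then y else 0)
if-then-0-cong true  x≡y = x≡y tt
if-then-0-cong false _   = refl

if-then-0-self : ∀ b {x y : ℕ} → x ≡ (if b then y else 0) → x ≡ (if b then x else 0)
if-then-0-self true  _   = refl
if-then-0-self false x≡0 = x≡0

T-slice : ∀ {k l i j} → T ((k ≤ᵇ i) ∧ (j <ᵇ l)) ⇔ (k ≤ i × j < l)
T-slice {k} {l} {i} {j} = mk⇔
  (λ t → let (k≤ᵇi , j<ᵇl) = to T-∧ t in ≤ᵇ⇒≤ k i k≤ᵇi , <ᵇ⇒< j l j<ᵇl)
  (λ (k≤i , j<l) → from T-∧ (≤⇒≤ᵇ k≤i , <⇒<ᵇ j<l))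

IsMax-0⇔ : ∀ {a b : ℕ → ℕ} →
  IsMax (λ c → + a c ℤ.- + b c) (+ 0) ⇔ ((∀ c → a c ≤ b c) × ∃ λ c → a c ≡ b c)
IsMax-0⇔ = mk⇔
  (λ ((c , attained) , bounded) →
     (λ c → ℤ.drop‿+≤+ (ℤ.i-j≤0⇒i≤j (bounded c))) ,
     c , ℤ.+-injective (ℤ.i-j≡0⇒i≡j _ _ attained))
  (λ (a≤b , c , a≡b) →
     (c , ℤ.i≡j⇒i-j≡0 (cong +_ a≡b)) , λ c → ℤ.i≤j⇒i-j≤0 (ℤ.+≤+ (a≤b c)))

suc-∸-≤ : ∀ m n → suc m ∸ n ≤ suc (m ∸ n)
suc-∸-≤ m       zero    = ≤-refl
suc-∸-≤ zero    (suc n) = ≤-trans (≤-reflexive (0∸n≡0 n)) z≤n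
suc-∸-≤ (suc m) (suc n) = suc-∸-≤ m n

∸-suc : ∀ {m n} → m < n → n ∸ m ≡ suc (n ∸ suc m)
∸-suc m<n = +-∸-assoc 1 m<n

suc<⇒<∸1 : ∀ {j l} → suc j < l → j < l ∸ 1
suc<⇒<∸1 {l = suc _} (s≤s j<l) = j<l

<∸1⇒suc< : ∀ {j l} → j < l ∸ 1 → suc j < l
<∸1⇒suc< {l = suc _} j<l = s≤s j<l

stepwise⇒monotone : ∀ {R : Rel ℕ 0ℓ} → Reflexive R → Transitive R →
  ∀ {f : ℕ → ℕ} → (∀ n → R (f n) (f (suc n))) → ∀ {m n} → m ≤ n → R (f m) (f n)
stepwise⇒monotone {R} refl-R trans-R {f} step {m} m≤n = go (≤⇒≤′ m≤n)
  where
  go : ∀ {n} → m ≤′ n → R (f m) (f n)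
  go ≤′-refl        = refl-R
  go (≤′-step m≤′n) = trans-R (go m≤′n) (step _)

-- Finite sums

sumTo-cong : ∀ {f g} n → (∀ t → t < n → f t ≡ g t) → sumTo f n ≡ sumTo g n
sumTo-cong zero    _   = refl
sumTo-cong (suc n) f≡g =
  cong₂ _+_ (sumTo-cong n λ t t<n → f≡g t (m≤n⇒m≤1+n t<n)) (f≡g n ≤-refl)

sumTo-mono : ∀ {f g} n → (∀ t → t < n → f t ≤ g t) → sumTo f n ≤ sumTo g n
sumTo-mono zero    _   = z≤n
sumTo-mono (suc n) f≤g =
  +-mono-≤ (sumTo-mono n λ t t<n → f≤g t (m≤n⇒m≤1+n t<n)) (f≤g n ≤-refl)

sumTo-mono-length : ∀ f {m n} → m ≤ n → sumTo f m ≤ sumTo f n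
sumTo-mono-length f = stepwise⇒monotone {R = _≤_} ≤-refl ≤-trans λ n → m≤m+n (sumTo f n) (f n)

sumTo-0 : ∀ n → sumTo (λ _ → 0) n ≡ 0
sumTo-0 zero    = refl
sumTo-0 (suc n) = trans (+-identityʳ _) (sumTo-0 n)

sumTo-+ : ∀ f g n → sumTo (λ t → f t + g t) n ≡ sumTo f n + sumTo g n
sumTo-+ f g zero    = refl
sumTo-+ f g (suc n) =
  trans (cong (_+ (f n + g n)) (sumTo-+ f g n)) (interchange (sumTo f n) (sumTo g n) (f n) (g n))

sumTo-comm : ∀ (g : ℕ → ℕ → ℕ) n m →
  sumTo (λ t → sumTo (g t) m) n ≡ sumTo (λ j → sumTo (λ t → g t j) n) m
sumTo-comm g zero    m = sym (sumTo-0 m)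
sumTo-comm g (suc n) m = trans (cong (_+ sumTo (g n) m) (sumTo-comm g n m))
                               (sym (sumTo-+ (λ j → sumTo (λ t → g t j) n) (g n) m))

sumTo-shift : ∀ f n → sumTo f (suc n) ≡ f 0 + sumTo (λ t → f (suc t)) n
sumTo-shift f zero    = +-comm 0 (f 0)
sumTo-shift f (suc n) = trans (cong (_+ f (suc n)) (sumTo-shift f n)) (+-assoc (f 0) _ _)

sumTo-zero-beyond : ∀ {f m n} → (∀ t → m ≤ t → f t ≡ 0) → m ≤ n → sumTo f n ≡ sumTo f m
sumTo-zero-beyond {f} {m} f≡0 m≤n = go (≤⇒≤′ m≤n)
  where
  go : ∀ {n} → m ≤′ n → sumTo f n ≡ sumTo f m
  go ≤′-refl            = refl
  go (≤′-step {n} m≤′n) = trans (cong₂ _+_ (go m≤′n) (f≡0 n (≤′⇒≤ m≤′n))) (+-identityʳ _)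

sumTo-≤-≥⇒≡ : ∀ {f g} n → (∀ t → t < n → f t ≤ g t) → sumTo g n ≤ sumTo f n →
  ∀ t → t < n → f t ≡ g t
sumTo-≤-≥⇒≡ {f} {g} (suc n) f≤g Σg≤Σf t t<1+n with m<1+n⇒m<n∨m≡n t<1+n
... | inj₁ t<n  = sumTo-≤-≥⇒≡ n f≤gₙ Σg≤Σfₙ t t<n
  where
  f≤gₙ : ∀ t → t < n → f t ≤ g t
  f≤gₙ t t<n = f≤g t (m≤n⇒m≤1+n t<n)
  Σg≤Σfₙ : sumTo g n ≤ sumTo f n
  Σg≤Σfₙ = +-cancelʳ-≤ (g n) _ _ (≤-trans Σg≤Σf (+-monoʳ-≤ (sumTo f n) (f≤g n ≤-refl)))
... | inj₂ refl =
  ≤-antisym (f≤g n ≤-refl) (+-cancelˡ-≤ (sumTo g n) _ _ (≤-trans Σg≤Σf Σf≤Σg+fₙ))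
  where
  Σf≤Σg+fₙ : sumTo f n + f n ≤ sumTo g n + f n
  Σf≤Σg+fₙ = +-monoˡ-≤ (f n) (sumTo-mono n λ t t<n → f≤g t (m≤n⇒m≤1+n t<n))

sumTo-telescope-up : ∀ {g h : ℕ → ℕ} → (∀ t → h (suc t) ≡ h t + g t) →
  ∀ n → h n ≡ h 0 + sumTo g n
sumTo-telescope-up {g} {h} step zero    = sym (+-identityʳ (h 0))
sumTo-telescope-up {g} {h} step (suc n) =
  trans (step n) (trans (cong (_+ g n) (sumTo-telescope-up step n)) (+-assoc (h 0) _ _))

sumTo-telescope-down : ∀ {g h : ℕ → ℕ} → (∀ t → h t ≡ g t + h (suc t)) →
  ∀ r n → h r ≡ sumTo (λ t → g (r + t)) n + h (r + n)
sumTo-telescope-down {g} {h} step r zero    = cong h (sym (+-identityʳ r))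
sumTo-telescope-down {g} {h} step r (suc n) = begin
  h r                                   ≡⟨ sumTo-telescope-down step r n ⟩
  G n + h (r + n)                       ≡⟨ cong (_+_ (G n)) (step (r + n)) ⟩
  G n + (g (r + n) + h (suc (r + n)))   ≡⟨ sym (+-assoc (G n) (g (r + n)) (h (suc (r + n)))) ⟩
  G (suc n) + h (suc (r + n))           ≡⟨ cong (λ x → G (suc n) + h x) (sym (+-suc r n)) ⟩
  G (suc n) + h (r + suc n)             ∎
  where
  open ≡-Reasoning
  G : ℕ → ℕ
  G = sumTo (λ t → g (r + t))

sumTo-guarded : ∀ (f : ℕ → ℕ) r B →
  sumTo (λ i → if r ≤ᵇ i then f i else 0) B ≡ sumTo (λ t → f (r + t)) (B ∸ r)
sumTo-guarded f r zero    = cong (sumTo (λ t → f (r + t))) (sym (0∸n≡0 r))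
sumTo-guarded f r (suc B) with r ≤? B
... | yes r≤B = begin
  _                          ≡⟨ cong₂ _+_ (sumTo-guarded f r B) (if-T (≤⇒≤ᵇ r≤B)) ⟩
  F (B ∸ r) + f B            ≡⟨ cong (λ i → F (B ∸ r) + f i) (sym (m+[n∸m]≡n r≤B)) ⟩
  F (suc (B ∸ r))            ≡⟨ cong F (sym (+-∸-assoc 1 r≤B)) ⟩
  F (suc B ∸ r)              ∎
  where
  open ≡-Reasoning
  F : ℕ → ℕ
  F = sumTo (λ t → f (r + t))
... | no r≰B = begin
  _                          ≡⟨ cong₂ _+_ (sumTo-guarded f r B) (if-¬T (r≰B ∘ ≤ᵇ⇒≤ r B)) ⟩
  F (B ∸ r) + 0              ≡⟨ +-identityʳ _ ⟩
  F (B ∸ r)                  ≡⟨ cong F (trans (m≤n⇒m∸n≡0 (<⇒≤ r>B)) (sym (m≤n⇒m∸n≡0 r>B))) ⟩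
  F (suc B ∸ r)              ∎
  where
  open ≡-Reasoning
  F : ℕ → ℕ
  F = sumTo (λ t → f (r + t))
  r>B : B < r
  r>B = ≰⇒> r≰B

-- Column tails

colTailFrom≡sumTo : ∀ M r j {n} → bound M ∸ r ≤ n →
  colTailFrom M r j ≡ sumTo (λ t → entry M (r + t) j) n
colTailFrom≡sumTo M r j B∸r≤n =
  trans (sumTo-guarded (λ i → entry M i j) r (bound M)) (sym (sumTo-zero-beyond vanishes B∸r≤n))
  where
  vanishes : ∀ t → bound M ∸ r ≤ t → entry M (r + t) j ≡ 0
  vanishes t B∸r≤t =
    proj₁ (support M (r + t) j) (≤-trans (m≤n+m∸n (bound M) r) (+-monoʳ-≤ r B∸r≤t))

colTailFrom-step : ∀ M r j → colTailFrom M r j ≡ entry M r j + colTailFrom M (suc r) j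
colTailFrom-step M r j = begin
  colTailFrom M r j
    ≡⟨ colTailFrom≡sumTo M r j (m≤n⇒m≤1+n (m∸n≤m B r)) ⟩
  sumTo (λ t → entry M (r + t) j) (suc B)
    ≡⟨ sumTo-shift _ B ⟩
  entry M (r + 0) j + sumTo (λ t → entry M (r + suc t) j) B
    ≡⟨ cong₂ _+_ (cong (λ i → entry M i j) (+-identityʳ r))
                 (sumTo-cong B λ t _ → cong (λ i → entry M i j) (+-suc r t)) ⟩
  entry M r j + sumTo (λ t → entry M (suc r + t) j) B
    ≡⟨ cong (_+_ (entry M r j)) (sym (colTailFrom≡sumTo M (suc r) j (m∸n≤m B (suc r)))) ⟩
  entry M r j + colTailFrom M (suc r) j
    ∎
  where
  open ≡-Reasoning
  B : ℕ
  B = bound M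

sumTo-colTailFrom : ∀ M r (g : ℕ → ℕ) L →
  sumTo (λ j → colTailFrom M r (g j)) L ≡
  sumTo (λ t → sumTo (λ j → entry M (r + t) (g j)) L) (bound M)
sumTo-colTailFrom M r g L =
  trans (sumTo-cong L λ j _ → colTailFrom≡sumTo M r (g j) (m∸n≤m (bound M) r))
        (sym (sumTo-comm (λ t j → entry M (r + t) (g j)) (bound M) L))

-- Partitions

part-antitone : ∀ λp {m n} → m ≤ n → part λp n ≤ part λp m
part-antitone λp = stepwise⇒monotone {R = flip _≤_} ≤-refl (flip ≤-trans) (decreasing λp)

prefixPartition : (ℕ → ℕ) → ℕ → Partition
prefixPartition f l = record
  { part       = λ n → sumTo f (l ∸ n)
  ; decreasing = λ n → sumTo-mono-length f (∸-monoʳ-≤ l (n≤1+n n))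
  ; finite     = l , λ n l≤n → cong (sumTo f) (m≤n⇒m∸n≡0 l≤n)
  }

prefixPartition-at-length : ∀ f l → part (prefixPartition f l) l ≡ 0
prefixPartition-at-length f l = cong (sumTo f) (n∸n≡0 l)

prefixPartition-gap : ∀ f {l} n a → l ≡ suc (n + a) →
  part (prefixPartition f l) n ∸ part (prefixPartition f l) (suc n) ≡ f a
prefixPartition-gap f n a refl = begin
  sumTo f (suc (n + a) ∸ n) ∸ sumTo f (n + a ∸ n)
    ≡⟨ cong₂ (λ x y → sumTo f x ∸ sumTo f y) 1+n+a∸n≡1+a (m+n∸m≡n n a) ⟩
  (sumTo f a + f a) ∸ sumTo f a
    ≡⟨ m+n∸m≡n (sumTo f a) (f a) ⟩
  f a
    ∎
  where
  open ≡-Reasoning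
  1+n+a∸n≡1+a : suc (n + a) ∸ n ≡ suc a
  1+n+a∸n≡1+a = trans (+-∸-assoc 1 (m≤m+n n a)) (cong suc (m+n∸m≡n n a))

-- Sliced forms

module SlicedForm⇒Conditions (k l : ℕ) (M : Mat) (λp : Partition) (λₗ≡0 : part λp l ≡ 0)
                             (sliced : ∀ i j → entry M i j ≡ slEntry λp k l i j) where

  private
    e : ℕ → ℕ → ℕ
    e = entry M
    p : ℕ → ℕ
    p = part λp

  -- The paper's m = i - k - j + l (as ℕ; truncation only matters outside the slice).
  diag : ℕ → ℕ → ℕ
  diag i j = (i ∸ k) + (l ∸ j)

  p-beyond : ∀ {n} → l ≤ n → p n ≡ 0
  p-beyond l≤n = n≤0⇒n≡0 (≤-trans (part-antitone λp l≤n) (≤-reflexive λₗ≡0))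

  diag-suc-col : ∀ {i j} → j < l → diag i j ≡ suc (diag i (suc j))
  diag-suc-col {i} {j} j<l = trans (cong (_+_ (i ∸ k)) (∸-suc j<l)) (+-suc (i ∸ k) (l ∸ suc j))

  diag-suc-suc : ∀ {r j} → k ≤ r → j < l → diag (suc r) (suc j) ≡ diag r j
  diag-suc-suc {r} {j} k≤r j<l =
    trans (cong (_+ (l ∸ suc j)) (+-∸-assoc 1 k≤r)) (sym (diag-suc-col j<l))

  diag≤diag-suc-suc : ∀ {i} → k ≤ i → ∀ c → diag i c ≤ diag (suc i) (suc c)
  diag≤diag-suc-suc {i} k≤i c = begin
    (i ∸ k) + (l ∸ c)          ≤⟨ +-monoʳ-≤ (i ∸ k) (suc-∸-≤ l (suc c)) ⟩
    (i ∸ k) + suc (l ∸ suc c)  ≡⟨ +-suc (i ∸ k) (l ∸ suc c) ⟩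
    suc (i ∸ k) + (l ∸ suc c)  ≡⟨ cong (_+ (l ∸ suc c)) (sym (+-∸-assoc 1 k≤i)) ⟩
    (suc i ∸ k) + (l ∸ suc c)  ∎
    where open ≤-Reasoning

  diag-suc-suc≤diag : ∀ {j} → suc j < l → ∀ r → diag (suc r) (suc (suc j)) ≤ diag r (suc j)
  diag-suc-suc≤diag {j} 1+j<l r =
    ≤-trans (+-monoˡ-≤ (l ∸ suc (suc j)) (suc-∸-≤ r k)) (≤-reflexive (sym (diag-suc-col 1+j<l)))

  entry-inside : ∀ {i j} → k ≤ i → j < l → e i j ≡ p (diag i (suc j)) ∸ p (suc (diag i (suc j)))
  entry-inside {i} {j} k≤i j<l =
    trans (sliced i j) (trans (if-T (from T-slice (k≤i , j<l)))
                              (cong (λ m → p (m ∸ 1) ∸ p m) (diag-suc-col j<l)))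

  entry-outside : ∀ {i j} → ¬ (k ≤ i × j < l) → e i j ≡ 0
  entry-outside outside = trans (sliced _ _) (if-¬T (outside ∘ to T-slice))

  entry-step : ∀ {i j} → k ≤ i → j < l → p (diag i (suc j)) ≡ e i j + p (diag i j)
  entry-step {i} {j} k≤i j<l = begin
    p n
      ≡⟨ sym (m∸n+n≡m (decreasing λp n)) ⟩
    (p n ∸ p (suc n)) + p (suc n)
      ≡⟨ cong₂ _+_ (sym (entry-inside k≤i j<l)) (cong p (sym (diag-suc-col j<l))) ⟩
    e i j + p (diag i j)
      ∎
    where
    open ≡-Reasoning
    n : ℕ
    n = diag i (suc j)

  rowSum≡ : ∀ {i} → k ≤ i → ∀ c → sumTo (e i) c ≡ p (diag i c)
  rowSum≡ {i} k≤i c = sym (trans (sumTo-telescope-up step c) (cong (_+ sumTo (e i) c) p₀≡0))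
    where
    p₀≡0 : p (diag i 0) ≡ 0
    p₀≡0 = p-beyond (m≤n+m l (i ∸ k))
    step : ∀ c → p (diag i (suc c)) ≡ p (diag i c) + e i c
    step c with c <? l
    ... | yes c<l = trans (entry-step k≤i c<l) (+-comm (e i c) _)
    ... | no  c≮l = begin
      p (diag i (suc c))
        ≡⟨ cong (λ x → p ((i ∸ k) + x)) (trans (m≤n⇒m∸n≡0 (m≤n⇒m≤1+n l≤c)) (sym (m≤n⇒m∸n≡0 l≤c))) ⟩
      p (diag i c)
        ≡⟨ sym (+-identityʳ _) ⟩
      p (diag i c) + 0
        ≡⟨ cong (_+_ (p (diag i c))) (sym (entry-outside (c≮l ∘ proj₂))) ⟩
      p (diag i c) + e i c
        ∎
      where
      open ≡-Reasoning
      l≤c : l ≤ c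
      l≤c = ≮⇒≥ c≮l

  colTail≡ : ∀ {j} → j < l → ∀ r → colTailFrom M r j ≡ p (diag r (suc j))
  colTail≡ {j} j<l r = begin
    colTailFrom M r j                 ≡⟨ colTailFrom≡sumTo M r j B∸r≤n ⟩
    E n                               ≡⟨ sym (+-identityʳ _) ⟩
    E n + 0                           ≡⟨ cong (_+_ (E n)) (sym (p-beyond l≤diag)) ⟩
    E n + p (diag (r + n) (suc j))    ≡⟨ sym (sumTo-telescope-down step r n) ⟩
    p (diag r (suc j))                ∎
    where
    open ≡-Reasoning
    E : ℕ → ℕ
    E = sumTo (λ t → e (r + t) j)
    n : ℕ
    n = bound M + (l + k)
    B∸r≤n : bound M ∸ r ≤ n
    B∸r≤n = ≤-trans (m∸n≤m (bound M) r) (m≤m+n (bound M) (l + k))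
    l≤diag : l ≤ diag (r + n) (suc j)
    l≤diag = ≤-trans (m+n≤o⇒m≤o∸n l (≤-trans (m≤n+m (l + k) (r + bound M))
                                              (≤-reflexive (+-assoc r (bound M) (l + k)))))
                     (m≤m+n ((r + n) ∸ k) (l ∸ suc j))
    step : ∀ t → p (diag t (suc j)) ≡ e t j + p (diag (suc t) (suc j))
    step t with k ≤? t
    ... | yes k≤t = trans (entry-step k≤t j<l) (cong (λ m → e t j + p m) (sym (diag-suc-suc k≤t j<l)))
    ... | no  k≰t = begin
      p (diag t (suc j))
        ≡⟨ cong (λ x → p (x + (l ∸ suc j))) (trans (m≤n⇒m∸n≡0 (<⇒≤ t<k)) (sym (m≤n⇒m∸n≡0 t<k))) ⟩
      p (diag (suc t) (suc j))
        ≡⟨ cong (_+ p (diag (suc t) (suc j))) (sym (entry-outside (k≰t ∘ proj₁))) ⟩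
      e t j + p (diag (suc t) (suc j))
        ∎
      where
      t<k : t < k
      t<k = ≰⇒> k≰t

  restricted : ∀ i j → e i j ≡ restrictEntry k l M i j
  restricted i j = if-then-0-self ((k ≤ᵇ i) ∧ (j <ᵇ l)) (sliced i j)

  εUp-vanishes : ∀ i → k ≤ i → εUp≡ M i (+ 0)
  εUp-vanishes i k≤i = from (IsMax-0⇔ {a} {b}) (a≤b , 0 , n≤0⇒n≡0 (a≤b 0))
    where
    a b : ℕ → ℕ
    a c = sumTo (e (suc i)) (suc c)
    b c = sumTo (e i) c
    a≤b : ∀ c → a c ≤ b c
    a≤b c = subst₂ _≤_ (sym (rowSum≡ (m≤n⇒m≤1+n k≤i) (suc c))) (sym (rowSum≡ k≤i c))
                       (part-antitone λp (diag≤diag-suc-suc k≤i c))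

  εRight-vanishes : ∀ j → j < l ∸ 1 → εRight≡ M j (+ 0)
  εRight-vanishes j j<l∸1 = from (IsMax-0⇔ {a} {b}) (a≤b , k , aₖ≡bₖ)
    where
    1+j<l : suc j < l
    1+j<l = <∸1⇒suc< j<l∸1
    a b : ℕ → ℕ
    a r = colTailFrom M r j
    b r = colTailFrom M (suc r) (suc j)
    a≤b : ∀ r → a r ≤ b r
    a≤b r = subst₂ _≤_ (sym (colTail≡ (<⇒≤ 1+j<l) r)) (sym (colTail≡ 1+j<l (suc r)))
                       (part-antitone λp (diag-suc-suc≤diag 1+j<l r))
    aₖ≡bₖ : a k ≡ b k
    aₖ≡bₖ = trans (colTail≡ (<⇒≤ 1+j<l) k)
                  (trans (cong p (sym (diag-suc-suc ≤-refl 1+j<l))) (sym (colTail≡ 1+j<l (suc k))))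

module Conditions⇒SlicedForm (k l : ℕ) (M : Mat)
                             (restricted : ∀ i j → entry M i j ≡ restrictEntry k l M i j)
                             (εUp-vanishes : ∀ i → k ≤ i → εUp≡ M i (+ 0))
                             (εRight-vanishes : ∀ j → j < l ∸ 1 → εRight≡ M j (+ 0)) where

  private
    e : ℕ → ℕ → ℕ
    e = entry M
    L : ℕ
    L = l ∸ 1

  row-dominated : ∀ {i} → k ≤ i → ∀ c → sumTo (e (suc i)) (suc c) ≤ sumTo (e i) c
  row-dominated k≤i = proj₁ (to IsMax-0⇔ (εUp-vanishes _ k≤i))

  first-column-vanishes : ∀ {i} → k ≤ i → e (suc i) 0 ≡ 0
  first-column-vanishes k≤i = n≤0⇒n≡0 (row-dominated k≤i 0)

  shifted-row-dominated : ∀ {i} → k ≤ i → sumTo (λ j → e (suc i) (suc j)) L ≤ sumTo (e i) L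
  shifted-row-dominated {i} k≤i = begin
    R L                      ≡⟨ cong (_+ R L) (sym (first-column-vanishes k≤i)) ⟩
    e (suc i) 0 + R L        ≡⟨ sym (sumTo-shift (e (suc i)) L) ⟩
    sumTo (e (suc i)) (suc L) ≤⟨ row-dominated k≤i L ⟩
    sumTo (e i) L            ∎
    where
    open ≤-Reasoning
    R : ℕ → ℕ
    R = sumTo (λ j → e (suc i) (suc j))

  column-tail-dominated : ∀ {j} → j < L → ∀ r → colTailFrom M r j ≤ colTailFrom M (suc r) (suc j)
  column-tail-dominated j<L = proj₁ (to IsMax-0⇔ (εRight-vanishes _ j<L))

  column-tails-summed : ∀ {r} → k ≤ r →
    sumTo (λ j → colTailFrom M (suc r) (suc j)) L ≤ sumTo (λ j → colTailFrom M r j) L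
  column-tails-summed {r} k≤r = begin
    sumTo (λ j → colTailFrom M (suc r) (suc j)) L
      ≡⟨ sumTo-colTailFrom M (suc r) suc L ⟩
    sumTo (λ t → sumTo (λ j → e (suc r + t) (suc j)) L) (bound M)
      ≤⟨ sumTo-mono (bound M) (λ t _ → shifted-row-dominated (≤-trans k≤r (m≤m+n r t))) ⟩
    sumTo (λ t → sumTo (λ j → e (r + t) j) L) (bound M)
      ≡⟨ sym (sumTo-colTailFrom M r (λ j → j) L) ⟩
    sumTo (λ j → colTailFrom M r j) L
      ∎
    where open ≤-Reasoning

  column-tails-equal : ∀ {r j} → k ≤ r → j < L → colTailFrom M r j ≡ colTailFrom M (suc r) (suc j)
  column-tails-equal {r} k≤r =
    sumTo-≤-≥⇒≡ L (λ j j<L → column-tail-dominated j<L r) (column-tails-summed k≤r) _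

  diagonal-step : ∀ {r j} → k ≤ r → j < L → e (suc r) (suc j) ≡ e r j
  diagonal-step {r} {j} k≤r j<L = +-cancelʳ-≡ (colTailFrom M (suc r) j) _ _ (begin
    e (suc r) (suc j) + colTailFrom M (suc r) j
      ≡⟨ cong (_+_ (e (suc r) (suc j))) (column-tails-equal (m≤n⇒m≤1+n k≤r) j<L) ⟩
    e (suc r) (suc j) + colTailFrom M (suc (suc r)) (suc j)
      ≡⟨ sym (colTailFrom-step M (suc r) (suc j)) ⟩
    colTailFrom M (suc r) (suc j)
      ≡⟨ sym (column-tails-equal k≤r j<L) ⟩
    colTailFrom M r j
      ≡⟨ colTailFrom-step M r j ⟩
    e r j + colTailFrom M (suc r) j
      ∎)
    where open ≡-Reasoning

  row-suc : ∀ s j → e (k + suc s) j ≡ e (suc (k + s)) j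
  row-suc s j = cong (λ i → e i j) (+-suc k s)

  diagonal-above : ∀ {s j} → s ≤ j → j < l → e (k + s) j ≡ e k (j ∸ s)
  diagonal-above {zero}  {j}     _         _   = cong (λ i → e i j) (+-identityʳ k)
  diagonal-above {suc s} {suc j} (s≤s s≤j) j<l =
    trans (row-suc s (suc j))
          (trans (diagonal-step (m≤m+n k s) (suc<⇒<∸1 j<l)) (diagonal-above s≤j (<⇒≤ j<l)))

  diagonal-below : ∀ {s j} → j < s → j < l → e (k + s) j ≡ 0
  diagonal-below {suc s} {zero}  _         _   = trans (row-suc s 0) (first-column-vanishes (m≤m+n k s))
  diagonal-below {suc s} {suc j} (s≤s j<s) j<l =
    trans (row-suc s (suc j))
          (trans (diagonal-step (m≤m+n k s) (suc<⇒<∸1 j<l)) (diagonal-below j<s (<⇒≤ j<l)))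

  λp : Partition
  λp = prefixPartition (e k) l

  entry-inside : ∀ {i j} → k ≤ i → j < l →
    e i j ≡ part λp (((i ∸ k) + (l ∸ j)) ∸ 1) ∸ part λp ((i ∸ k) + (l ∸ j))
  entry-inside {i} {j} k≤i j<l = begin
    e i j
      ≡⟨ cong (λ i → e i j) (sym (m+[n∸m]≡n k≤i)) ⟩
    e (k + s) j
      ≡⟨ diagonal ⟩
    part λp (s + q) ∸ part λp (suc (s + q))
      ≡⟨ cong (λ m → part λp (m ∸ 1) ∸ part λp m) (sym s+[l∸j]≡1+s+q) ⟩
    part λp ((s + (l ∸ j)) ∸ 1) ∸ part λp (s + (l ∸ j))
      ∎
    where
    open ≡-Reasoning
    s q : ℕ
    s = i ∸ k
    q = l ∸ suc j
    l≡1+j+q : l ≡ suc (j + q)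
    l≡1+j+q = sym (m+[n∸m]≡n j<l)
    s+[l∸j]≡1+s+q : s + (l ∸ j) ≡ suc (s + q)
    s+[l∸j]≡1+s+q = trans (cong (_+_ s) (∸-suc j<l)) (+-suc s q)
    diagonal : e (k + s) j ≡ part λp (s + q) ∸ part λp (suc (s + q))
    diagonal with s ≤? j
    ... | yes s≤j = trans (diagonal-above s≤j j<l)
                          (sym (prefixPartition-gap (e k) (s + q) (j ∸ s) l≡1+s+q+[j∸s]))
      where
      l≡1+s+q+[j∸s] : l ≡ suc ((s + q) + (j ∸ s))
      l≡1+s+q+[j∸s] = trans l≡1+j+q (cong suc (trans (cong (_+ q) (sym (m+[n∸m]≡n s≤j)))
                                                      (xy∙z≈xz∙y s (j ∸ s) q)))
    ... | no  s≰j = trans (diagonal-below (≰⇒> s≰j) j<l)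
                          (sym (cong₂ _∸_ (vanishes l≤s+q) (vanishes (m≤n⇒m≤1+n l≤s+q))))
      where
      l≤s+q : l ≤ s + q
      l≤s+q = ≤-trans (≤-reflexive l≡1+j+q) (+-monoˡ-≤ q (≰⇒> s≰j))
      vanishes : ∀ {n} → l ≤ n → part λp n ≡ 0
      vanishes = proj₂ (finite λp) _

  sliced : ∀ i j → e i j ≡ slEntry λp k l i j
  sliced i j = trans (restricted i j) (if-then-0-cong ((k ≤ᵇ i) ∧ (j <ᵇ l))
    λ t → let (k≤i , j<l) = to T-slice t in entry-inside k≤i j<l)

mainTheorem6 : (k l : ℕ) → 0 < l → (M : Mat) →
    ((∀ i j → entry M i j ≡ restrictEntry k l M i j)
      × (∀ i → k ≤ i → εUp≡ M i (+ 0))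
      × (∀ j → j < l ∸ 1 → εRight≡ M j (+ 0)))
    ⇔ (∃ λ (λp : Partition) → (part λp l ≡ 0)
      × (∀ i j → entry M i j ≡ slEntry λp k l i j))
mainTheorem6 k l _ M = mk⇔
  (λ (restricted , εUp-vanishes , εRight-vanishes) →
     let open Conditions⇒SlicedForm k l M restricted εUp-vanishes εRight-vanishes
     in λp , prefixPartition-at-length (entry M k) l , sliced)
  (λ (λp , λₗ≡0 , sliced) →
     let open SlicedForm⇒Conditions k l M λp λₗ≡0 sliced
     in restricted , εUp-vanishes , εRight-vanishes)
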